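{- Let $k\in\mathbb{N}$ and $L\in\{\mathrm{FO}_k,\mathrm{MSO}_k\}$. If $\phi$ is a sentence of $L$, then $\mu(\phi)\le N_L$ and $\nu(\phi)\le N_L$.
   Context: Words are nonempty finite words over $\Sigma=\{l,r\}$, identified with word models (positions with linear order $<$ and unary predicates $P_l,P_r$). FO and MSO formulas are over $\{<,P_l,P_r\}$. Quantifier rank: $0$ for atomic formulas, unchanged by $\neg$, maximum over $\wedge,\vee$, and each first- or second-order quantifier adds $1$. $\mathrm{FO}_k$ (resp. $\mathrm{MSO}_k$) is the set of FO (resp. MSO) formulas of quantifier rank at most $k$. $w\equiv_L v$ iff $w,v$ satisfy the same $L$-sentences; $N_L$ is the number of $\equiv_L$-classes on $\Sigma$-words. For a sentence $\phi$: $\mu(\phi)$ is the minimal length of a word satisfying $\phi$ ($0$ if none); $\nu(\phi)$ is the maximal length of a word satisfying $\phi$, with $\nu(\phi)=0$ if $\phi$ has no models or has arbitrarily long models. -}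

module Defs where

open import Data.Nat using (ℕ; zero; suc; _≤_; _⊔_)
open import Data.Fin using (Fin; zero; suc)
open import Data.Fin.Subset using (Subset; _∈_)
open import Data.List using (List; length; lookup)
open import Data.List.NonEmpty using (List⁺; toList)
open import Data.Product using (Σ; _×_; _,_)
open import Data.Sum using (_⊎_)
open import Data.Empty using (⊥)
open import Relation.Binary.PropositionalEquality using (_≡_; _≢_)
open import Relation.Nullary using (¬_)
open import Function.Bundles using (_⇔_)

data Letter : Set where
  l r : Letter

Word : Set
Word = List⁺ Letter

∣_∣ : Word → ℕ
∣ w ∣ = length (toList w)

Pos : Word → Set
Pos w = Fin ∣ w ∣

letterAt : (w : Word) → Pos w → Letter
letterAt w i = lookup (toList w) i

-- MSO formulas over {<, P_l, P_r} with n free first-order variables and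
-- m free second-order (set) variables, in de Bruijn style.
data Formula (n m : ℕ) : Set where
  _≐_   : Fin n → Fin n → Formula n m
  _<′_  : Fin n → Fin n → Formula n m
  P     : Letter → Fin n → Formula n m
  _∈′_  : Fin n → Fin m → Formula n m
  ¬′_   : Formula n m → Formula n m
  _∧′_  : Formula n m → Formula n m → Formula n m
  _∨′_  : Formula n m → Formula n m → Formula n m
  ∃₁ ∀₁ : Formula (suc n) m → Formula n m
  ∃₂ ∀₂ : Formula n (suc m) → Formula n m

qr : ∀ {n m} → Formula n m → ℕ
qr (x ≐ y) = 0
qr (x <′ y) = 0
qr (P a x) = 0
qr (x ∈′ X) = 0
qr (¬′ φ) = qr φ
qr (φ ∧′ ψ) = qr φ ⊔ qr ψ
qr (φ ∨′ ψ) = qr φ ⊔ qr ψ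
qr (∃₁ φ) = suc (qr φ)
qr (∀₁ φ) = suc (qr φ)
qr (∃₂ φ) = suc (qr φ)
qr (∀₂ φ) = suc (qr φ)

data IsFO {n m : ℕ} : Formula n m → Set where
  fo-≐ : ∀ x y → IsFO (x ≐ y)
  fo-< : ∀ x y → IsFO (x <′ y)
  fo-P : ∀ a x → IsFO (P a x)
  fo-¬ : ∀ {φ} → IsFO φ → IsFO (¬′ φ)
  fo-∧ : ∀ {φ ψ} → IsFO φ → IsFO ψ → IsFO (φ ∧′ ψ)
  fo-∨ : ∀ {φ ψ} → IsFO φ → IsFO ψ → IsFO (φ ∨′ ψ)
  fo-∃ : ∀ {φ} → IsFO {suc n} {m} φ → IsFO (∃₁ φ)
  fo-∀ : ∀ {φ} → IsFO {suc n} {m} φ → IsFO (∀₁ φ)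

Sentence : Set
Sentence = Formula 0 0

ext : ∀ {A : Set} {n} → A → (Fin n → A) → Fin (suc n) → A
ext a ρ zero = a
ext a ρ (suc i) = ρ i

Sat : ∀ {n m} (w : Word) → (Fin n → Pos w) → (Fin m → Subset ∣ w ∣) → Formula n m → Set
Sat w ρ σ (x ≐ y) = ρ x ≡ ρ y
Sat w ρ σ (x <′ y) = Data.Fin._<_ (ρ x) (ρ y)
Sat w ρ σ (P a x) = letterAt w (ρ x) ≡ a
Sat w ρ σ (x ∈′ X) = ρ x ∈ σ X
Sat w ρ σ (¬′ φ) = ¬ Sat w ρ σ φ
Sat w ρ σ (φ ∧′ ψ) = Sat w ρ σ φ × Sat w ρ σ ψ
Sat w ρ σ (φ ∨′ ψ) = Sat w ρ σ φ ⊎ Sat w ρ σ ψ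
Sat w ρ σ (∃₁ φ) = Σ (Pos w) λ i → Sat w (ext i ρ) σ φ
Sat w ρ σ (∀₁ φ) = (i : Pos w) → Sat w (ext i ρ) σ φ
Sat w ρ σ (∃₂ φ) = Σ (Subset ∣ w ∣) λ S → Sat w ρ (ext S σ) φ
Sat w ρ σ (∀₂ φ) = (S : Subset ∣ w ∣) → Sat w ρ (ext S σ) φ

noVar : ∀ {A : Set} → Fin 0 → A
noVar ()

_⊨_ : Word → Sentence → Set
w ⊨ φ = Sat w noVar noVar φ

data Logic : Set where
  FO MSO : Logic

InL : Logic → ℕ → Sentence → Set
InL FO  k φ = IsFO φ × qr φ ≤ k
InL MSO k φ = qr φ ≤ k

Equiv : Logic → ℕ → Word → Word → Set
Equiv L k w v = (φ : Sentence) → InL L k φ → (w ⊨ φ) ⇔ (v ⊨ φ)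

-- "N_{L_k} = N": ≡_{L_k} has exactly N classes, witnessed by N pairwise
-- inequivalent representatives such that every word is equivalent to one.
NumClasses : Logic → ℕ → ℕ → Set
NumClasses L k N =
  Σ (Fin N → Word) λ rep →
    ((i j : Fin N) → i ≢ j → ¬ Equiv L k (rep i) (rep j)) ×
    ((w : Word) → Σ (Fin N) λ i → Equiv L k w (rep i))

IsMu : Sentence → ℕ → Set
IsMu φ m =
  (((w : Word) → ¬ (w ⊨ φ)) × m ≡ 0)
  ⊎ ((Σ Word λ w → (w ⊨ φ) × ∣ w ∣ ≡ m) × ((w : Word) → w ⊨ φ → m ≤ ∣ w ∣))

IsNu : Sentence → ℕ → Set
IsNu φ m =
  (((w : Word) → ¬ (w ⊨ φ)) × m ≡ 0)
  ⊎ (((b : ℕ) → Σ Word λ w → (w ⊨ φ) × b ≤ ∣ w ∣) × m ≡ 0)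
  ⊎ ((Σ Word λ w → (w ⊨ φ) × ∣ w ∣ ≡ m) × ((w : Word) → w ⊨ φ → ∣ w ∣ ≤ m))

{-# OPTIONS --safe #-}
-- A sentence φ of L does not distinguish a ∷ u from a ∷ v when u ≡_L v:
-- its left quotient by a, in which every quantifier ranges either over u or
-- over the removed first letter, has the same rank, stays first-order, and
-- holds in u iff φ holds in a ∷ u.  So ≡_L is a congruence for prepending.
-- If φ had a model w of minimal (maximal) length > N, by pigeonhole two
-- suffixes sᵢ, sⱼ (i < j) of w would be equivalent, and replacing sᵢ by sⱼ
-- (sⱼ by sᵢ) in w would give a shorter (longer) model.
module Submission where

open import Defs
open import Data.Bool using (Bool; true; false; _≟_)
open import Data.Nat as ℕ using (ℕ; suc; _+_; _≤_; _<_; _⊔_; z≤n; s≤s)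
open import Data.Nat.Properties
  using ( ⊔-idem; +-identityʳ; +-suc; +-assoc; +-comm; +-monoˡ-<; +-cancelʳ-<; ≮⇒≥; <⇒≱
        ; module ≤-Reasoning)
open import Data.Fin as Fin using (Fin; zero; suc; toℕ)
open import Data.Fin.Properties using (suc-injective; pigeonhole)
open import Data.Fin.Subset using (Subset; _∈_)
open import Data.Fin.Subset.Properties using (drop-there)
open import Data.List as List using (List; []; _∷_)
open import Data.List.NonEmpty using (_∷_; _∷⁺_; _++⁺_)
open import Data.List.NonEmpty.Properties using (length-++⁺)
open import Data.Vec using (_∷_; here; there)
open import Data.Product using (Σ; _×_; _,_; proj₁; proj₂)
open import Data.Product.Function.NonDependent.Propositional using (_×-⇔_)
open import Data.Sum using (inj₁; inj₂)
open import Data.Sum.Function.Propositional using (_⊎-⇔_)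
open import Data.Empty using (⊥; ⊥-elim)
open import Relation.Nullary using (¬_; Dec; yes; no)
open import Relation.Binary.PropositionalEquality
open import Function.Bundles using (_⇔_; mk⇔; Equivalence)
open import Function.Construct.Identity using (⇔-id)
open import Function.Construct.Symmetry using (⇔-sym)
open import Function.Construct.Composition using (_⇔-∘_)
open import Function.Related.TypeIsomorphisms using (¬-cong-⇔)
open Equivalence using (to; from)

_≟ᴸ_ : (a b : Letter) → Dec (a ≡ b)
l ≟ᴸ l = yes refl
l ≟ᴸ r = no λ ()
r ≟ᴸ l = no λ ()
r ≟ᴸ r = yes refl

module _ {n m : ℕ} where

  -- Without truth constants, true and false of rank 0 must mention a variable.
  ⊤′ ⊥′ : Fin n → Formula n m
  ⊤′ i = i ≐ i
  ⊥′ i = ¬′ (i ≐ i)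

  decided : {A : Set} → Dec A → Fin n → Formula n m
  decided (yes _) = ⊤′
  decided (no _)  = ⊥′

  ≐-atom <-atom : Bool → Bool → Fin n → Fin n → Formula n m
  ≐-atom true  true  x y = ⊤′ x
  ≐-atom true  false x y = ⊥′ x
  ≐-atom false true  x y = ⊥′ x
  ≐-atom false false x y = x ≐ y
  <-atom true  true  x y = ⊥′ x
  <-atom true  false x y = ⊤′ x
  <-atom false true  x y = ⊥′ x
  <-atom false false x y = x <′ y

  P-atom : Letter → Bool → Letter → Fin n → Formula n m
  P-atom a true  c x = decided (a ≟ᴸ c) x
  P-atom a false c x = P c x

  ∈-atom : Bool → Bool → Fin n → Fin m → Formula n m
  ∈-atom true  s x X = decided (s ≟ true) x
  ∈-atom false s x X = x ∈′ X

  qr-decided : ∀ {A} (d : Dec A) x → qr (decided d x) ≡ 0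
  qr-decided (yes _) x = refl
  qr-decided (no _)  x = refl

  qr-≐-atom : ∀ b c x y → qr (≐-atom b c x y) ≡ 0
  qr-≐-atom true  true  x y = refl
  qr-≐-atom true  false x y = refl
  qr-≐-atom false true  x y = refl
  qr-≐-atom false false x y = refl

  qr-<-atom : ∀ b c x y → qr (<-atom b c x y) ≡ 0
  qr-<-atom true  true  x y = refl
  qr-<-atom true  false x y = refl
  qr-<-atom false true  x y = refl
  qr-<-atom false false x y = refl

  qr-P-atom : ∀ a b c x → qr (P-atom a b c x) ≡ 0
  qr-P-atom a true  c x = qr-decided (a ≟ᴸ c) x
  qr-P-atom a false c x = refl

  qr-∈-atom : ∀ b s x X → qr (∈-atom b s x X) ≡ 0
  qr-∈-atom true  s x X = qr-decided (s ≟ true) x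
  qr-∈-atom false s x X = refl

  IsFO-decided : ∀ {A} (d : Dec A) x → IsFO (decided d x)
  IsFO-decided (yes _) x = fo-≐ x x
  IsFO-decided (no _)  x = fo-¬ (fo-≐ x x)

  IsFO-≐-atom : ∀ b c x y → IsFO (≐-atom b c x y)
  IsFO-≐-atom true  true  x y = fo-≐ x x
  IsFO-≐-atom true  false x y = fo-¬ (fo-≐ x x)
  IsFO-≐-atom false true  x y = fo-¬ (fo-≐ x x)
  IsFO-≐-atom false false x y = fo-≐ x y

  IsFO-<-atom : ∀ b c x y → IsFO (<-atom b c x y)
  IsFO-<-atom true  true  x y = fo-¬ (fo-≐ x x)
  IsFO-<-atom true  false x y = fo-≐ x x
  IsFO-<-atom false true  x y = fo-¬ (fo-≐ x x)
  IsFO-<-atom false false x y = fo-< x y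

  IsFO-P-atom : ∀ a b c x → IsFO (P-atom a b c x)
  IsFO-P-atom a true  c x = IsFO-decided (a ≟ᴸ c) x
  IsFO-P-atom a false c x = fo-P c x

⊔-idem-≡ : ∀ {p q r} → p ≡ r → q ≡ r → p ⊔ q ≡ r
⊔-idem-≡ refl refl = ⊔-idem _

module _ (a : Letter) where

  -- leftQuotient a pin bit φ holds in u iff φ holds in a ∷⁺ u, where the
  -- variables i with pin i = true point at the first position a (the variable
  -- i of the translation is then a dummy) and bit X tells whether a lies in X.
  leftQuotient : ∀ {n m} → (Fin n → Bool) → (Fin m → Bool) → Formula n m → Formula n m
  leftQuotient pin bit (x ≐ y)  = ≐-atom (pin x) (pin y) x y
  leftQuotient pin bit (x <′ y) = <-atom (pin x) (pin y) x y
  leftQuotient pin bit (P c x)  = P-atom a (pin x) c x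
  leftQuotient pin bit (x ∈′ X) = ∈-atom (pin x) (bit X) x X
  leftQuotient pin bit (¬′ φ)   = ¬′ leftQuotient pin bit φ
  leftQuotient pin bit (φ ∧′ ψ) = leftQuotient pin bit φ ∧′ leftQuotient pin bit ψ
  leftQuotient pin bit (φ ∨′ ψ) = leftQuotient pin bit φ ∨′ leftQuotient pin bit ψ
  leftQuotient pin bit (∃₁ φ) =
    ∃₁ (leftQuotient (ext false pin) bit φ ∨′ leftQuotient (ext true pin) bit φ)
  leftQuotient pin bit (∀₁ φ) =
    ∀₁ (leftQuotient (ext false pin) bit φ ∧′ leftQuotient (ext true pin) bit φ)
  leftQuotient pin bit (∃₂ φ) =
    ∃₂ (leftQuotient pin (ext false bit) φ) ∨′ ∃₂ (leftQuotient pin (ext true bit) φ)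
  leftQuotient pin bit (∀₂ φ) =
    ∀₂ (leftQuotient pin (ext false bit) φ) ∧′ ∀₂ (leftQuotient pin (ext true bit) φ)

  qr-leftQuotient : ∀ {n m} pin bit (φ : Formula n m) → qr (leftQuotient pin bit φ) ≡ qr φ
  qr-leftQuotient pin bit (x ≐ y)  = qr-≐-atom (pin x) (pin y) x y
  qr-leftQuotient pin bit (x <′ y) = qr-<-atom (pin x) (pin y) x y
  qr-leftQuotient pin bit (P c x)  = qr-P-atom a (pin x) c x
  qr-leftQuotient pin bit (x ∈′ X) = qr-∈-atom (pin x) (bit X) x X
  qr-leftQuotient pin bit (¬′ φ)   = qr-leftQuotient pin bit φ
  qr-leftQuotient pin bit (φ ∧′ ψ) =
    cong₂ _⊔_ (qr-leftQuotient pin bit φ) (qr-leftQuotient pin bit ψ)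
  qr-leftQuotient pin bit (φ ∨′ ψ) =
    cong₂ _⊔_ (qr-leftQuotient pin bit φ) (qr-leftQuotient pin bit ψ)
  qr-leftQuotient pin bit (∃₁ φ) = cong suc
    (⊔-idem-≡ (qr-leftQuotient (ext false pin) bit φ) (qr-leftQuotient (ext true pin) bit φ))
  qr-leftQuotient pin bit (∀₁ φ) = cong suc
    (⊔-idem-≡ (qr-leftQuotient (ext false pin) bit φ) (qr-leftQuotient (ext true pin) bit φ))
  qr-leftQuotient pin bit (∃₂ φ) = ⊔-idem-≡
    (cong suc (qr-leftQuotient pin (ext false bit) φ)) (cong suc (qr-leftQuotient pin (ext true bit) φ))
  qr-leftQuotient pin bit (∀₂ φ) = ⊔-idem-≡
    (cong suc (qr-leftQuotient pin (ext false bit) φ)) (cong suc (qr-leftQuotient pin (ext true bit) φ))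

  IsFO-leftQuotient : ∀ {n m} pin bit {φ : Formula n m} → IsFO φ → IsFO (leftQuotient pin bit φ)
  IsFO-leftQuotient pin bit (fo-≐ x y) = IsFO-≐-atom (pin x) (pin y) x y
  IsFO-leftQuotient pin bit (fo-< x y) = IsFO-<-atom (pin x) (pin y) x y
  IsFO-leftQuotient pin bit (fo-P c x) = IsFO-P-atom a (pin x) c x
  IsFO-leftQuotient pin bit (fo-¬ h)   = fo-¬ (IsFO-leftQuotient pin bit h)
  IsFO-leftQuotient pin bit (fo-∧ h g) =
    fo-∧ (IsFO-leftQuotient pin bit h) (IsFO-leftQuotient pin bit g)
  IsFO-leftQuotient pin bit (fo-∨ h g) =
    fo-∨ (IsFO-leftQuotient pin bit h) (IsFO-leftQuotient pin bit g)
  IsFO-leftQuotient pin bit (fo-∃ h) =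
    fo-∃ (fo-∨ (IsFO-leftQuotient (ext false pin) bit h) (IsFO-leftQuotient (ext true pin) bit h))
  IsFO-leftQuotient pin bit (fo-∀ h) =
    fo-∀ (fo-∧ (IsFO-leftQuotient (ext false pin) bit h) (IsFO-leftQuotient (ext true pin) bit h))

  InL-leftQuotient : ∀ L {k} pin bit {φ : Sentence} →
    InL L k φ → InL L k (leftQuotient pin bit φ)
  InL-leftQuotient FO  pin bit {φ} (fo , qr≤k) =
    IsFO-leftQuotient pin bit fo , subst (_≤ _) (sym (qr-leftQuotient pin bit φ)) qr≤k
  InL-leftQuotient MSO pin bit {φ} qr≤k = subst (_≤ _) (sym (qr-leftQuotient pin bit φ)) qr≤k

zeroIf : ∀ {c} → Bool → Fin c → Fin (suc c)
zeroIf true  _ = zero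
zeroIf false p = suc p

module _ {c : ℕ} where

  Pinned : ∀ {n} → (Fin n → Bool) → (Fin n → Fin (suc c)) → (Fin n → Fin c) → Set
  Pinned pin ρ ρ′ = ∀ i → ρ i ≡ zeroIf (pin i) (ρ′ i)

  Split : ∀ {m} → (Fin m → Bool) → (Fin m → Subset (suc c)) → (Fin m → Subset c) → Set
  Split bit σ σ′ = ∀ X → σ X ≡ bit X ∷ σ′ X

  Pinned-ext : ∀ {n pin ρ ρ′} → Pinned {n} pin ρ ρ′ →
    ∀ b j → Pinned (ext b pin) (ext (zeroIf b j) ρ) (ext j ρ′)
  Pinned-ext hρ b j zero    = refl
  Pinned-ext hρ b j (suc i) = hρ i

  Split-ext : ∀ {m bit σ σ′} → Split {m} bit σ σ′ →
    ∀ b S → Split (ext b bit) (ext (b ∷ S) σ) (ext S σ′)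
  Split-ext hσ b S zero    = refl
  Split-ext hσ b S (suc X) = hσ X

module _ {u : Word} {n m : ℕ} {ρ′ : Fin n → Pos u} {σ′ : Fin m → Subset ∣ u ∣} where

  private
    ⊨_ : Formula n m → Set
    ⊨ φ = Sat u ρ′ σ′ φ

  Sat-⊤′ : ∀ {A : Set} {x} → A → (⊨ ⊤′ x) ⇔ A
  Sat-⊤′ a = mk⇔ (λ _ → a) (λ _ → refl)

  Sat-⊥′ : ∀ {A : Set} {x} → ¬ A → (⊨ ⊥′ x) ⇔ A
  Sat-⊥′ ¬a = mk⇔ (λ ¬refl → ⊥-elim (¬refl refl)) (λ a → ⊥-elim (¬a a))

  Sat-decided : ∀ {A : Set} (d : Dec A) x → (⊨ decided d x) ⇔ A
  Sat-decided (yes a) x = Sat-⊤′ a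
  Sat-decided (no ¬a) x = Sat-⊥′ ¬a

  Sat-≐-atom : ∀ b c x y → (⊨ ≐-atom b c x y) ⇔ (zeroIf b (ρ′ x) ≡ zeroIf c (ρ′ y))
  Sat-≐-atom true  true  x y = Sat-⊤′ refl
  Sat-≐-atom true  false x y = Sat-⊥′ λ ()
  Sat-≐-atom false true  x y = Sat-⊥′ λ ()
  Sat-≐-atom false false x y = mk⇔ (cong suc) suc-injective

  Sat-<-atom : ∀ b c x y → (⊨ <-atom b c x y) ⇔ (zeroIf b (ρ′ x) Fin.< zeroIf c (ρ′ y))
  Sat-<-atom true  true  x y = Sat-⊥′ λ ()
  Sat-<-atom true  false x y = Sat-⊤′ (s≤s z≤n)
  Sat-<-atom false true  x y = Sat-⊥′ λ ()
  Sat-<-atom false false x y = mk⇔ s≤s ℕ.s≤s⁻¹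

  Sat-P-atom : ∀ a b c x → (⊨ P-atom a b c x) ⇔ (letterAt (a ∷⁺ u) (zeroIf b (ρ′ x)) ≡ c)
  Sat-P-atom a true  c x = Sat-decided (a ≟ᴸ c) x
  Sat-P-atom a false c x = ⇔-id _

  Sat-∈-atom : ∀ b s x X → (⊨ ∈-atom b s x X) ⇔ (zeroIf b (ρ′ x) ∈ (s ∷ σ′ X))
  Sat-∈-atom true  s x X = mk⇔ (λ { refl → here }) (λ { here → refl }) ⇔-∘ Sat-decided (s ≟ true) x
  Sat-∈-atom false s x X = mk⇔ there drop-there

module _ {a : Letter} {u : Word} where

  -- In the quantifier cases the pinned branch needs some position of u for
  -- its dummy variable; zero exists since words are nonempty.
  Sat-leftQuotient : ∀ {n m} (φ : Formula n m) {pin bit ρ σ ρ′ σ′} →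
    Pinned pin ρ ρ′ → Split bit σ σ′ →
    Sat (a ∷⁺ u) ρ σ φ ⇔ Sat u ρ′ σ′ (leftQuotient a pin bit φ)
  Sat-leftQuotient (x ≐ y) {pin} hρ hσ rewrite hρ x | hρ y =
    ⇔-sym (Sat-≐-atom (pin x) (pin y) x y)
  Sat-leftQuotient (x <′ y) {pin} hρ hσ rewrite hρ x | hρ y =
    ⇔-sym (Sat-<-atom (pin x) (pin y) x y)
  Sat-leftQuotient (P c x) {pin} hρ hσ rewrite hρ x =
    ⇔-sym (Sat-P-atom a (pin x) c x)
  Sat-leftQuotient (x ∈′ X) {pin} {bit} hρ hσ rewrite hρ x | hσ X =
    ⇔-sym (Sat-∈-atom (pin x) (bit X) x X)
  Sat-leftQuotient (¬′ φ)   hρ hσ = ¬-cong-⇔ (Sat-leftQuotient φ hρ hσ)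
  Sat-leftQuotient (φ ∧′ ψ) hρ hσ = Sat-leftQuotient φ hρ hσ ×-⇔ Sat-leftQuotient ψ hρ hσ
  Sat-leftQuotient (φ ∨′ ψ) hρ hσ = Sat-leftQuotient φ hρ hσ ⊎-⇔ Sat-leftQuotient ψ hρ hσ
  Sat-leftQuotient (∃₁ φ) {pin} {bit} {ρ} {σ} {ρ′} {σ′} hρ hσ = mk⇔
    (λ { (zero  , s) → zero , inj₂ (to (ih true zero) s)
       ; (suc j , s) → j , inj₁ (to (ih false j) s) })
    (λ { (j , inj₁ s) → suc j , from (ih false j) s
       ; (j , inj₂ s) → zero , from (ih true j) s })
    where
    ih : ∀ b j → Sat (a ∷⁺ u) (ext (zeroIf b j) ρ) σ φ
                   ⇔ Sat u (ext j ρ′) σ′ (leftQuotient a (ext b pin) bit φ)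
    ih b j = Sat-leftQuotient φ (Pinned-ext hρ b j) hσ
  Sat-leftQuotient (∀₁ φ) {pin} {bit} {ρ} {σ} {ρ′} {σ′} hρ hσ = mk⇔
    (λ s j → to (ih false j) (s (suc j)) , to (ih true j) (s zero))
    (λ { s zero    → from (ih true zero) (proj₂ (s zero))
       ; s (suc j) → from (ih false j) (proj₁ (s j)) })
    where
    ih : ∀ b j → Sat (a ∷⁺ u) (ext (zeroIf b j) ρ) σ φ
                   ⇔ Sat u (ext j ρ′) σ′ (leftQuotient a (ext b pin) bit φ)
    ih b j = Sat-leftQuotient φ (Pinned-ext hρ b j) hσ
  Sat-leftQuotient (∃₂ φ) {pin} {bit} {ρ} {σ} {ρ′} {σ′} hρ hσ = mk⇔
    (λ { (false ∷ S , s) → inj₁ (S , to (ih false S) s)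
       ; (true  ∷ S , s) → inj₂ (S , to (ih true S) s) })
    (λ { (inj₁ (S , s)) → false ∷ S , from (ih false S) s
       ; (inj₂ (S , s)) → true ∷ S , from (ih true S) s })
    where
    ih : ∀ b S → Sat (a ∷⁺ u) ρ (ext (b ∷ S) σ) φ
                   ⇔ Sat u ρ′ (ext S σ′) (leftQuotient a pin (ext b bit) φ)
    ih b S = Sat-leftQuotient φ hρ (Split-ext hσ b S)
  Sat-leftQuotient (∀₂ φ) {pin} {bit} {ρ} {σ} {ρ′} {σ′} hρ hσ = mk⇔
    (λ s → (λ S → to (ih false S) (s (false ∷ S))) , (λ S → to (ih true S) (s (true ∷ S))))
    (λ { s (false ∷ S) → from (ih false S) (proj₁ s S)
       ; s (true  ∷ S) → from (ih true S) (proj₂ s S) })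
    where
    ih : ∀ b S → Sat (a ∷⁺ u) ρ (ext (b ∷ S) σ) φ
                   ⇔ Sat u ρ′ (ext S σ′) (leftQuotient a pin (ext b bit) φ)
    ih b S = Sat-leftQuotient φ hρ (Split-ext hσ b S)

⊨-leftQuotient : ∀ a u (φ : Sentence) → ((a ∷⁺ u) ⊨ φ) ⇔ (u ⊨ leftQuotient a noVar noVar φ)
⊨-leftQuotient a u φ = Sat-leftQuotient φ (λ ()) (λ ())

module _ {L : Logic} {k : ℕ} where

  Equiv-sym : ∀ {u v} → Equiv L k u v → Equiv L k v u
  Equiv-sym u≡v φ hφ = ⇔-sym (u≡v φ hφ)

  Equiv-trans : ∀ {u v w} → Equiv L k u v → Equiv L k v w → Equiv L k u w
  Equiv-trans u≡v v≡w φ hφ = v≡w φ hφ ⇔-∘ u≡v φ hφ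

  Equiv-∷⁺ : ∀ a {u v} → Equiv L k u v → Equiv L k (a ∷⁺ u) (a ∷⁺ v)
  Equiv-∷⁺ a {u} {v} u≡v φ hφ =
    ⇔-sym (⊨-leftQuotient a v φ)
      ⇔-∘ (u≡v _ (InL-leftQuotient a L noVar noVar hφ) ⇔-∘ ⊨-leftQuotient a u φ)

  Equiv-++⁺ : ∀ (y : List Letter) {u v} → Equiv L k u v → Equiv L k (y ++⁺ u) (y ++⁺ v)
  Equiv-++⁺ []      u≡v = u≡v
  Equiv-++⁺ (a ∷ y) u≡v = Equiv-∷⁺ a (Equiv-++⁺ y u≡v)

prefix : (w : Word) → Pos w → List Letter
prefix (a ∷ t)     zero    = []
prefix (a ∷ b ∷ t) (suc i) = a ∷ prefix (b ∷ t) i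

suffix : (w : Word) → Pos w → Word
suffix w           zero    = w
suffix (a ∷ b ∷ t) (suc i) = suffix (b ∷ t) i

prefix++⁺suffix : ∀ w i → prefix w i ++⁺ suffix w i ≡ w
prefix++⁺suffix (a ∷ t)     zero    = refl
prefix++⁺suffix (a ∷ b ∷ t) (suc i) = cong (a ∷⁺_) (prefix++⁺suffix (b ∷ t) i)

length-prefix : ∀ w i → List.length (prefix w i) ≡ toℕ i
length-prefix (a ∷ t)     zero    = refl
length-prefix (a ∷ b ∷ t) (suc i) = cong suc (length-prefix (b ∷ t) i)

length-suffix : ∀ w i → ∣ suffix w i ∣ + toℕ i ≡ ∣ w ∣
length-suffix w           zero    = +-identityʳ ∣ w ∣
length-suffix (a ∷ b ∷ t) (suc i) = trans (+-suc _ (toℕ i)) (cong suc (length-suffix (b ∷ t) i))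

length-prefix++⁺suffix : ∀ w i j → ∣ prefix w i ++⁺ suffix w j ∣ + toℕ j ≡ toℕ i + ∣ w ∣
length-prefix++⁺suffix w i j = begin
  ∣ prefix w i ++⁺ suffix w j ∣ + toℕ j
    ≡⟨ cong (_+ toℕ j) (length-++⁺ (prefix w i) (suffix w j)) ⟩
  List.length (prefix w i) + ∣ suffix w j ∣ + toℕ j
    ≡⟨ +-assoc (List.length (prefix w i)) _ _ ⟩
  List.length (prefix w i) + (∣ suffix w j ∣ + toℕ j)
    ≡⟨ cong₂ _+_ (length-prefix w i) (length-suffix w j) ⟩
  toℕ i + ∣ w ∣
    ∎
  where open ≡-Reasoning

module _ {L : Logic} {k N : ℕ} (rep : Fin N → Word)
         (classify : ∀ w → Σ (Fin N) λ c → Equiv L k w (rep c)) where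

  equivalentSuffixes : ∀ w → N < ∣ w ∣ →
    Σ (Pos w) λ i → Σ (Pos w) λ j → i Fin.< j × Equiv L k (suffix w i) (suffix w j)
  equivalentSuffixes w N<∣w∣ with pigeonhole N<∣w∣ (λ i → proj₁ (classify (suffix w i)))
  ... | i , j , i<j , same-class = i , j , i<j , Equiv-trans (proj₂ (classify (suffix w i))) rep≡sⱼ
    where
    rep≡sⱼ : Equiv L k (rep (proj₁ (classify (suffix w i)))) (suffix w j)
    rep≡sⱼ rewrite same-class = Equiv-sym (proj₂ (classify (suffix w j)))

  module _ {φ : Sentence} (hφ : InL L k φ) where

    ⊨-exchange : ∀ w i j → Equiv L k (suffix w i) (suffix w j) →
      w ⊨ φ → (prefix w i ++⁺ suffix w j) ⊨ φ
    ⊨-exchange w i j sᵢ≡sⱼ w⊨φ =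
      to (Equiv-++⁺ (prefix w i) sᵢ≡sⱼ φ hφ) (subst (_⊨ φ) (sym (prefix++⁺suffix w i)) w⊨φ)

    shorterModel : ∀ {w} → w ⊨ φ → N < ∣ w ∣ → Σ Word λ w′ → (w′ ⊨ φ) × ∣ w′ ∣ < ∣ w ∣
    shorterModel {w} w⊨φ N<∣w∣ with equivalentSuffixes w N<∣w∣
    ... | i , j , i<j , sᵢ≡sⱼ =
      prefix w i ++⁺ suffix w j , ⊨-exchange w i j sᵢ≡sⱼ w⊨φ ,
      +-cancelʳ-< (toℕ j) _ _ (begin-strict
        ∣ prefix w i ++⁺ suffix w j ∣ + toℕ j ≡⟨ length-prefix++⁺suffix w i j ⟩
        toℕ i + ∣ w ∣                         <⟨ +-monoˡ-< ∣ w ∣ i<j ⟩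
        toℕ j + ∣ w ∣                         ≡⟨ +-comm (toℕ j) ∣ w ∣ ⟩
        ∣ w ∣ + toℕ j                         ∎)
      where open ≤-Reasoning

    longerModel : ∀ {w} → w ⊨ φ → N < ∣ w ∣ → Σ Word λ w′ → (w′ ⊨ φ) × ∣ w ∣ < ∣ w′ ∣
    longerModel {w} w⊨φ N<∣w∣ with equivalentSuffixes w N<∣w∣
    ... | i , j , i<j , sᵢ≡sⱼ =
      prefix w j ++⁺ suffix w i , ⊨-exchange w j i (Equiv-sym sᵢ≡sⱼ) w⊨φ ,
      +-cancelʳ-< (toℕ i) _ _ (begin-strict
        ∣ w ∣ + toℕ i                         ≡⟨ +-comm ∣ w ∣ (toℕ i) ⟩
        toℕ i + ∣ w ∣                         <⟨ +-monoˡ-< ∣ w ∣ i<j ⟩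
        toℕ j + ∣ w ∣                         ≡⟨ sym (length-prefix++⁺suffix w j i) ⟩
        ∣ prefix w j ++⁺ suffix w i ∣ + toℕ i ∎)
      where open ≤-Reasoning

proposition2 : (k : ℕ) (L : Logic) (N : ℕ) → NumClasses L k N →
    (φ : Sentence) → InL L k φ →
    ((m : ℕ) → IsMu φ m → m ≤ N) × ((m : ℕ) → IsNu φ m → m ≤ N)
proposition2 k L N (rep , _ , classify) φ hφ = μ≤N , ν≤N
  where
    μ≤N : (m : ℕ) → IsMu φ m → m ≤ N
    μ≤N m (inj₁ (_ , refl)) = z≤n
    μ≤N m (inj₂ ((w , w⊨φ , refl) , minimal)) = ≮⇒≥ λ N<∣w∣ →
      let (w′ , w′⊨φ , shorter) = shorterModel rep classify hφ w⊨φ N<∣w∣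
      in <⇒≱ shorter (minimal w′ w′⊨φ)

    ν≤N : (m : ℕ) → IsNu φ m → m ≤ N
    ν≤N m (inj₁ (_ , refl)) = z≤n
    ν≤N m (inj₂ (inj₁ (_ , refl))) = z≤n
    ν≤N m (inj₂ (inj₂ ((w , w⊨φ , refl) , maximal))) = ≮⇒≥ λ N<∣w∣ →
      let (w′ , w′⊨φ , longer) = longerModel rep classify hφ w⊨φ N<∣w∣
      in <⇒≱ longer (maximal w′ w′⊨φ)
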